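{- Let $n=p_1^{n_1}p_2^{n_2}\cdots p_r^{n_r}$, where $r\geq 2$, $n_1,\ldots,n_r$ are positive integers and $p_1,\ldots,p_r$ are distinct primes with $p_1<p_2<\cdots<p_r$. Then for every integer $k$ with $0\leq k\leq n_r-1$, $$\kappa(\mathcal{P}(C_n))\leq \phi(n)+p_1^{n_1-1}\cdots p_{r-1}^{n_{r-1}-1}\left[p_r^{n_r-1}\phi(p_1\cdots p_{r-1})+p_r^{k}\left[p_1\cdots p_{r-1}-2\phi(p_1\cdots p_{r-1})\right]\right].$$
   Context: $C_n$ is the cyclic group of order $n$ and $\phi$ is Euler's totient function. The power graph $\mathcal{P}(C_n)$ is the simple undirected graph with vertex set $C_n$ in which two distinct vertices are adjacent if and only if one of them is a power of the other. $\kappa(\mathcal{P}(C_n))$ denotes its vertex connectivity: the minimum number of vertices whose removal leaves an induced subgraph that is disconnected or has only one vertex. -}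

module Defs where

open import Data.Nat using (ℕ; zero; suc; _+_; _*_; _∸_; _^_; _<_; _≤_)
open import Data.Nat.GCD using (gcd)
open import Data.Nat.Primality using (Prime)
open import Data.Fin using (Fin; toℕ; fromℕ; inject₁)
import Data.Fin as F
open import Data.Fin.Subset using (Subset; _∈_; _∉_; ∣_∣)
open import Data.List using (List; length; filter; map; upTo)
open import Data.Product using (Σ; ∃; ∃-syntax; _×_; _,_)
open import Data.Sum using (_⊎_)
open import Relation.Nullary using (¬_)
open import Relation.Binary.PropositionalEquality using (_≡_)
import Data.Nat as N

φ : ℕ → ℕ
φ n = length (filter (λ k → gcd k n N.≟ 1) (map suc (upTo n)))

∏ : {m : ℕ} → (Fin m → ℕ) → ℕ
∏ {zero}  f = 1
∏ {suc m} f = f F.zero * ∏ (λ i → f (F.suc i))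

-- C_n modelled as the additive group ℤ/nℤ with carrier Fin n
-- (element x ↔ residue toℕ x).  "x is a power of y" in multiplicative
-- notation means x = m·y (mod n) for some m ∈ ℕ.
IsPowerOf : (n : ℕ) → Fin n → Fin n → Set
IsPowerOf n x y = ∃[ m ] ∃[ q ] (m * toℕ y ≡ toℕ x + q * n)

PowerAdj : (n : ℕ) → Fin n → Fin n → Set
PowerAdj n x y = ¬ (x ≡ y) × (IsPowerOf n x y ⊎ IsPowerOf n y x)

data Reach {n : ℕ} (Adj : Fin n → Fin n → Set) (S : Subset n) : Fin n → Fin n → Set where
  here : ∀ {u} → u ∉ S → Reach Adj S u u
  step : ∀ {u v w} → u ∉ S → Adj u v → Reach Adj S v w → Reach Adj S u w

Disconnected : {n : ℕ} → (Fin n → Fin n → Set) → Subset n → Set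
Disconnected Adj S = ∃[ u ] ∃[ v ] (u ∉ S × v ∉ S × ¬ Reach Adj S u v)

OneVertexLeft : {n : ℕ} → Subset n → Set
OneVertexLeft {n} S = ∣ S ∣ + 1 ≡ n

IsSeparating : {n : ℕ} → (Fin n → Fin n → Set) → Subset n → Set
IsSeparating Adj S = Disconnected Adj S ⊎ OneVertexLeft S

IsVertexConnectivity : {n : ℕ} → (Fin n → Fin n → Set) → ℕ → Set
IsVertexConnectivity {n} Adj κ =
  (∃[ S ] (IsSeparating Adj S × ∣ S ∣ ≡ κ)) ×
  (∀ (S : Subset n) → IsSeparating Adj S → κ ≤ ∣ S ∣)

-- Write P = p₁⋯p_{r−1}, t = p_r^{n_r−k} and m′ = p₁^{n₁−1}⋯p_{r−1}^{n_{r−1}−1}, and remove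
-- from ℤ/n the set S of residues x for which exactly one of "gcd(x, P) = 1" and "t ∣ x"
-- holds. The rest splits into the residues with both properties (among them t) and those
-- with neither (among them P), and no power-graph edge joins the two classes, because a
-- divisor of n that divides x divides every power of x (apply this to t and to gcd(y, P)).
-- So κ ≤ |S|, and by inclusion–exclusion
--   |S| = #{x ⊥ P} + #{t ∣ x} − 2·#{x ⊥ P, t ∣ x} = p_r^{n_r} m′φ(P) + p_r^k m′P − 2p_r^k m′φ(P),
-- which is the stated bound once φ(n) = (p_r^{n_r} − p_r^{n_r−1}) m′φ(P) is substituted.

module Submission where

open import Defs
open import Data.Nat using (ℕ; suc; _^_; _<_; _≤_; _∸_)
open import Data.Nat.Primality using (Prime)
open import Data.Fin using (Fin; fromℕ; inject₁)

module Counting where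

  open import Data.Bool using (Bool; true; false; _∧_; _xor_; not)
  open import Data.Bool.Properties using (∧-identityʳ; ∧-zeroʳ)
  open import Data.Nat
  open import Data.Nat.Properties
  open import Data.Nat.Divisibility
  open import Data.Nat.Tactic.RingSolver using (solve-∀)
  open import Data.List using (length; filter; applyUpTo; [_]; _++_)
  open import Data.List.Properties using (applyUpTo-∷ʳ; filter-++; length-++)
  open import Data.Fin using (toℕ)
  open import Data.Fin.Subset using (∣_∣)
  open import Data.Vec using (tabulate; _∷_)
  open import Function using (_∘_)
  open import Relation.Nullary using (does)
  open import Relation.Nullary.Decidable using (dec-true; dec-false)
  open import Relation.Unary using (Pred; Decidable)
  open import Relation.Binary.PropositionalEquality using (_≡_; refl; sym; trans; cong; cong₂; module ≡-Reasoning)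
  open ≡-Reasoning

  indicator : Bool → ℕ
  indicator true  = 1
  indicator false = 0

  sumBelow : (ℕ → ℕ) → ℕ → ℕ
  sumBelow u zero    = 0
  sumBelow u (suc N) = sumBelow u N + u N

  count : (ℕ → Bool) → ℕ → ℕ
  count f = sumBelow (indicator ∘ f)

  module _ {u v : ℕ → ℕ} where

    sumBelow-cong : (∀ x → u x ≡ v x) → ∀ N → sumBelow u N ≡ sumBelow v N
    sumBelow-cong u≗v zero    = refl
    sumBelow-cong u≗v (suc N) = cong₂ _+_ (sumBelow-cong u≗v N) (u≗v N)

    sumBelow-+ : ∀ N → sumBelow (λ x → u x + v x) N ≡ sumBelow u N + sumBelow v N
    sumBelow-+ zero    = refl
    sumBelow-+ (suc N) rewrite sumBelow-+ N = interchange (sumBelow u N) (sumBelow v N) (u N) (v N)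
      where
      interchange : ∀ a b c d → a + b + (c + d) ≡ a + c + (b + d)
      interchange = solve-∀

  sumBelow-*ˡ : ∀ c u N → sumBelow (λ x → c * u x) N ≡ c * sumBelow u N
  sumBelow-*ˡ c u zero    = sym (*-zeroʳ c)
  sumBelow-*ˡ c u (suc N) rewrite sumBelow-*ˡ c u N = sym (*-distribˡ-+ c (sumBelow u N) (u N))

  sumBelow-+-range : ∀ u M N → sumBelow u (M + N) ≡ sumBelow u M + sumBelow (λ x → u (M + x)) N
  sumBelow-+-range u M zero    = trans (cong (sumBelow u) (+-identityʳ M)) (sym (+-identityʳ _))
  sumBelow-+-range u M (suc N) rewrite +-suc M N | sumBelow-+-range u M N = +-assoc (sumBelow u M) _ _

  sumBelow-periodic : ∀ u c → (∀ x → u (c + x) ≡ u x) → ∀ j → sumBelow u (j * c) ≡ j * sumBelow u c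
  sumBelow-periodic u c periodic zero    = refl
  sumBelow-periodic u c periodic (suc j) = begin
    sumBelow u (c + j * c)                          ≡⟨ sumBelow-+-range u c (j * c) ⟩
    sumBelow u c + sumBelow (λ x → u (c + x)) (j * c) ≡⟨ cong (sumBelow u c +_) (sumBelow-cong periodic (j * c)) ⟩
    sumBelow u c + sumBelow u (j * c)                ≡⟨ cong (sumBelow u c +_) (sumBelow-periodic u c periodic j) ⟩
    sumBelow u c + j * sumBelow u c                  ∎

  sumBelow-zero : ∀ u N → (∀ x → x < N → u x ≡ 0) → sumBelow u N ≡ 0
  sumBelow-zero u zero    vanish = refl
  sumBelow-zero u (suc N) vanish
    rewrite vanish N ≤-refl | sumBelow-zero u N (λ x x<N → vanish x (m<n⇒m<1+n x<N)) = refl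

  count-cong : ∀ {f g} → (∀ x → f x ≡ g x) → ∀ N → count f N ≡ count g N
  count-cong f≗g = sumBelow-cong (cong indicator ∘ f≗g)

  count-true : ∀ N → count (λ _ → true) N ≡ N
  count-true zero    = refl
  count-true (suc N) rewrite count-true N = +-comm N 1

  count-periodic : ∀ f c → (∀ x → f (c + x) ≡ f x) → ∀ j → count f (j * c) ≡ j * count f c
  count-periodic f c periodic = sumBelow-periodic (indicator ∘ f) c (cong indicator ∘ periodic)

  count-shift : ∀ f N → f N ≡ f 0 → count (f ∘ suc) N ≡ count f N
  count-shift f N fN≡f0 = +-cancelˡ-≡ (indicator (f 0)) _ _ (begin
    indicator (f 0) + count (f ∘ suc) N ≡⟨ sym (sumBelow-+-range (indicator ∘ f) 1 N) ⟩
    count f N + indicator (f N)         ≡⟨ cong (λ b → count f N + indicator b) fN≡f0 ⟩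
    count f N + indicator (f 0)         ≡⟨ +-comm (count f N) _ ⟩
    indicator (f 0) + count f N         ∎)

  -- Of dM, dM + 1, …, dM + d − 1 only the first is a multiple of d.
  count-multiples-block : ∀ d .{{_ : NonZero d}} (h : ℕ → Bool) M →
    sumBelow (λ z → indicator (h (d * M + z) ∧ does (d ∣? d * M + z))) d ≡ indicator (h (d * M))
  count-multiples-block d@(suc d-1) h M = begin
    sumBelow u (1 + d-1)         ≡⟨ sumBelow-+-range u 1 d-1 ⟩
    u 0 + sumBelow (u ∘ suc) d-1 ≡⟨ cong₂ _+_ first others ⟩
    indicator (h (d * M)) + 0    ≡⟨ +-identityʳ _ ⟩
    indicator (h (d * M))        ∎
    where
    u : ℕ → ℕ
    u z = indicator (h (d * M + z) ∧ does (d ∣? d * M + z))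
    first : u 0 ≡ indicator (h (d * M))
    first rewrite +-identityʳ (d * M) | dec-true (d ∣? d * M) (m∣m*n M) | ∧-identityʳ (h (d * M)) = refl
    others : sumBelow (u ∘ suc) d-1 ≡ 0
    others = sumBelow-zero (u ∘ suc) d-1 λ z z<d-1 →
      let d∤ = λ d∣ → <⇒≱ (s≤s z<d-1) (∣⇒≤ (∣m+n∣m⇒∣n d∣ (m∣m*n M))) in
      cong indicator (trans (cong (h (d * M + suc z) ∧_) (dec-false (d ∣? d * M + suc z) d∤)) (∧-zeroʳ _))

  count-multiples : ∀ d .{{_ : NonZero d}} (h : ℕ → Bool) M →
    count (λ x → h x ∧ does (d ∣? x)) (d * M) ≡ count (h ∘ (d *_)) M
  count-multiples d h zero    rewrite *-zeroʳ d = refl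
  count-multiples d h (suc M) = begin
    count F (d * suc M)                                      ≡⟨ cong (count F) (trans (*-suc d M) (+-comm d (d * M))) ⟩
    count F (d * M + d)                                      ≡⟨ sumBelow-+-range (indicator ∘ F) (d * M) d ⟩
    count F (d * M) + sumBelow (indicator ∘ F ∘ (d * M +_)) d ≡⟨ cong₂ _+_ (count-multiples d h M) (count-multiples-block d h M) ⟩
    count (h ∘ (d *_)) (suc M)                               ∎
    where
    F : ℕ → Bool
    F x = h x ∧ does (d ∣? x)

  module _ (f g : ℕ → Bool) where

    count-∧-not : ∀ N → count (λ x → f x ∧ not (g x)) N + count (λ x → f x ∧ g x) N ≡ count f N
    count-∧-not N = trans (sym (sumBelow-+ N)) (sumBelow-cong (λ x → split (f x) (g x)) N)
      where
      split : ∀ a b → indicator (a ∧ not b) + indicator (a ∧ b) ≡ indicator a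
      split true  true  = refl
      split true  false = refl
      split false _     = refl

    count-xor : ∀ N → count (λ x → f x xor g x) N + 2 * count (λ x → f x ∧ g x) N ≡ count f N + count g N
    count-xor N = begin
      count (λ x → f x xor g x) N + 2 * count (λ x → f x ∧ g x) N
        ≡⟨ cong (count (λ x → f x xor g x) N +_) (sym (sumBelow-*ˡ 2 (indicator ∘ (λ x → f x ∧ g x)) N)) ⟩
      count (λ x → f x xor g x) N + sumBelow (λ x → 2 * indicator (f x ∧ g x)) N
        ≡⟨ sym (sumBelow-+ N) ⟩
      sumBelow (λ x → indicator (f x xor g x) + 2 * indicator (f x ∧ g x)) N
        ≡⟨ sumBelow-cong (λ x → inclusion-exclusion (f x) (g x)) N ⟩
      sumBelow (λ x → indicator (f x) + indicator (g x)) N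
        ≡⟨ sumBelow-+ N ⟩
      count f N + count g N ∎
      where
      inclusion-exclusion : ∀ a b → indicator (a xor b) + 2 * indicator (a ∧ b) ≡ indicator a + indicator b
      inclusion-exclusion true  true  = refl
      inclusion-exclusion true  false = refl
      inclusion-exclusion false true  = refl
      inclusion-exclusion false false = refl

  length-filter-applyUpTo : ∀ {p} {P : Pred ℕ p} (P? : Decidable P) h N →
    length (filter P? (applyUpTo h N)) ≡ count (does ∘ P? ∘ h) N
  length-filter-applyUpTo P? h zero    = refl
  length-filter-applyUpTo P? h (suc N) = begin
    length (filter P? (applyUpTo h (suc N)))                       ≡⟨ cong (length ∘ filter P?) (sym (applyUpTo-∷ʳ h N)) ⟩
    length (filter P? (applyUpTo h N ++ [ h N ]))                  ≡⟨ cong length (filter-++ P? (applyUpTo h N) [ h N ]) ⟩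
    length (filter P? (applyUpTo h N) ++ filter P? [ h N ])         ≡⟨ length-++ (filter P? (applyUpTo h N)) ⟩
    length (filter P? (applyUpTo h N)) + length (filter P? [ h N ]) ≡⟨ cong₂ _+_ (length-filter-applyUpTo P? h N) singleton ⟩
    count (does ∘ P? ∘ h) (suc N) ∎
    where
    singleton : length (filter P? [ h N ]) ≡ indicator (does (P? (h N)))
    singleton with does (P? (h N))
    ... | true  = refl
    ... | false = refl

  ∣tabulate∣≡count : ∀ n (f : ℕ → Bool) → ∣ tabulate {n = n} (f ∘ toℕ) ∣ ≡ count f n
  ∣tabulate∣≡count zero    f = refl
  ∣tabulate∣≡count (suc n) f = trans (front (f 0)) (sym (sumBelow-+-range (indicator ∘ f) 1 n))
    where
    front : ∀ b → ∣ b ∷ tabulate {n = n} (f ∘ suc ∘ toℕ) ∣ ≡ indicator b + count (f ∘ suc) n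
    front true  = cong suc (∣tabulate∣≡count n (f ∘ suc))
    front false = ∣tabulate∣≡count n (f ∘ suc)

module Arithmetic where

  open Counting
  open import Data.Bool using (Bool; _∧_)
  open import Data.Nat
  open import Data.Nat.Properties
  open import Data.Nat.Divisibility
  open import Data.Nat.Primality using (prime⇒irreducible; ¬prime[1])
  open import Data.Nat.Coprimality using (Coprime; coprime?; coprime-divisor; gcd≡1⇒coprime; coprime⇒gcd≡1)
    renaming (sym to coprime-sym)
  open import Data.Nat.GCD using (gcd)
  open import Data.Nat.Tactic.RingSolver using (solve-∀)
  open import Data.List using (length; filter; applyUpTo)
  open import Data.List.Properties using (map-upTo)
  import Data.Fin as Fin
  open import Data.Empty using (⊥-elim)
  open import Data.Product using (_×_; _,_; proj₁; proj₂; map)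
  open import Data.Sum using (inj₁; inj₂)
  open import Function using (_∘_; id)
  open import Function.Bundles using (_⇔_; mk⇔; Equivalence)
  open import Relation.Nullary using (¬_; Dec; does)
  open import Relation.Nullary.Decidable using (does-⇔)
  open import Relation.Binary.PropositionalEquality using (_≡_; _≢_; refl; sym; trans; cong; cong₂; subst; module ≡-Reasoning)
  open Equivalence using (to; from)


  ∏-cong : ∀ {m} {f g : Fin m → ℕ} → (∀ i → f i ≡ g i) → ∏ f ≡ ∏ g
  ∏-cong {zero}  f≗g = refl
  ∏-cong {suc m} f≗g = cong₂ _*_ (f≗g Fin.zero) (∏-cong (f≗g ∘ Fin.suc))

  ∏-* : ∀ {m} (f g : Fin m → ℕ) → ∏ (λ i → f i * g i) ≡ ∏ f * ∏ g
  ∏-* {zero}  f g = refl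
  ∏-* {suc m} f g rewrite ∏-* (f ∘ Fin.suc) (g ∘ Fin.suc) = interchange (f Fin.zero) (g Fin.zero) _ _
    where
    interchange : ∀ a b c d → a * b * (c * d) ≡ a * c * (b * d)
    interchange = solve-∀

  ∏-init-last : ∀ m (f : Fin (suc m) → ℕ) → ∏ f ≡ ∏ (f ∘ inject₁) * f (fromℕ m)
  ∏-init-last zero    f = *-comm (f Fin.zero) 1
  ∏-init-last (suc m) f rewrite ∏-init-last m (f ∘ Fin.suc) = sym (*-assoc (f Fin.zero) _ _)

  ∏-nonZero : ∀ {m} (f : Fin m → ℕ) → (∀ i → NonZero (f i)) → NonZero (∏ f)
  ∏-nonZero {zero}  f _  = _
  ∏-nonZero {suc m} f f≢0 = m*n≢0 _ _ {{f≢0 Fin.zero}} {{∏-nonZero (f ∘ Fin.suc) (f≢0 ∘ Fin.suc)}}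

  ∣-∏ : ∀ {m} (f : Fin m → ℕ) i → f i ∣ ∏ f
  ∣-∏ f Fin.zero    = m∣m*n _
  ∣-∏ f (Fin.suc i) = ∣-trans (∣-∏ (f ∘ Fin.suc) i) (n∣m*n (f Fin.zero))

  ∣-^ : ∀ {a e} → 1 ≤ e → a ∣ a ^ e
  ∣-^ {a} {suc e} _ = m∣m*n (a ^ e)

  suc[n∸1]≡n : ∀ {n} → 1 ≤ n → suc (n ∸ 1) ≡ n
  suc[n∸1]≡n {suc n} _ = refl

  ∣∧∤⇒< : ∀ {a d n} .{{_ : NonZero n}} → a ∣ n → d ∣ n → ¬ d ∣ a → a < n
  ∣∧∤⇒< a∣n d∣n d∤a = ≤∧≢⇒< (∣⇒≤ a∣n) (λ { refl → d∤a d∣n })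

  prime-∣⇒≢1 : ∀ {q x} → Prime q → q ∣ x → x ≢ 1
  prime-∣⇒≢1 q-prime q∣x refl = ¬prime[1] (subst Prime (∣1⇒≡1 q∣x) q-prime)

  coprime-∣ˡ : ∀ {d x n} → d ∣ x → Coprime x n → Coprime d n
  coprime-∣ˡ d∣x x⊥n (e∣d , e∣n) = x⊥n (∣-trans e∣d d∣x , e∣n)

  coprime-∣ʳ : ∀ {d x n} → d ∣ n → Coprime x n → Coprime x d
  coprime-∣ʳ d∣n x⊥n (e∣x , e∣d) = x⊥n (e∣x , ∣-trans e∣d d∣n)

  coprime-*ʳ⇔ : ∀ {x a b} → Coprime x (a * b) ⇔ (Coprime x a × Coprime x b)
  coprime-*ʳ⇔ {x} {a} {b} = mk⇔ split join
    where
    split : Coprime x (a * b) → Coprime x a × Coprime x b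
    split x⊥ab = coprime-∣ʳ (m∣m*n {a} b) x⊥ab , coprime-∣ʳ (n∣m*n a {b}) x⊥ab
    join : Coprime x a × Coprime x b → Coprime x (a * b)
    join (x⊥a , x⊥b) (d∣x , d∣ab) = x⊥b (d∣x , coprime-divisor (coprime-∣ˡ d∣x x⊥a) d∣ab)

  coprime-*ˡ⇔ : ∀ {c n y} → Coprime c n → Coprime (c * y) n ⇔ Coprime y n
  coprime-*ˡ⇔ {c} c⊥n = mk⇔
    (coprime-sym ∘ proj₂ ∘ to (coprime-*ʳ⇔ {a = c}) ∘ coprime-sym)
    (λ y⊥n → coprime-sym (from coprime-*ʳ⇔ (coprime-sym c⊥n , coprime-sym y⊥n)))

  coprime-^⇔ : ∀ {x a e} → 1 ≤ e → Coprime x (a ^ e) ⇔ Coprime x a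
  coprime-^⇔ {e = suc zero} _ = mk⇔
    (coprime-∣ʳ (∣-reflexive (sym (*-identityʳ _))))
    (coprime-∣ʳ (∣-reflexive (*-identityʳ _)))
  coprime-^⇔ {a = a} {suc (suc e)} _ = mk⇔
    (proj₁ ∘ to (coprime-*ʳ⇔ {b = a ^ suc e}))
    (λ x⊥a → from coprime-*ʳ⇔ (x⊥a , from (coprime-^⇔ {e = suc e} (s≤s z≤n)) x⊥a))

  coprime-∏ : ∀ {x m} (f : Fin m → ℕ) → (∀ i → Coprime x (f i)) → Coprime x (∏ f)
  coprime-∏ {m = zero}  f _   (_ , d∣1) = ∣1⇒≡1 d∣1
  coprime-∏ {m = suc m} f x⊥f = from coprime-*ʳ⇔ (x⊥f Fin.zero , coprime-∏ (f ∘ Fin.suc) (x⊥f ∘ Fin.suc))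

  coprime-∏-^⇔ : ∀ {x m} (f e : Fin m → ℕ) → (∀ i → 1 ≤ e i) →
    Coprime x (∏ (λ i → f i ^ e i)) ⇔ Coprime x (∏ f)
  coprime-∏-^⇔ {m = zero}  f e _   = mk⇔ id id
  coprime-∏-^⇔ {x} {suc m} f e e≥1 = mk⇔
    (from coprime-*ʳ⇔ ∘ map (to head⇔) (to tail⇔) ∘ to coprime-*ʳ⇔)
    (from coprime-*ʳ⇔ ∘ map (from head⇔) (from tail⇔) ∘ to coprime-*ʳ⇔)
    where
    head⇔ : Coprime x (f Fin.zero ^ e Fin.zero) ⇔ Coprime x (f Fin.zero)
    head⇔ = coprime-^⇔ (e≥1 Fin.zero)
    tail⇔ : Coprime x (∏ (λ i → f (Fin.suc i) ^ e (Fin.suc i))) ⇔ Coprime x (∏ (f ∘ Fin.suc))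
    tail⇔ = coprime-∏-^⇔ (f ∘ Fin.suc) (e ∘ Fin.suc) (e≥1 ∘ Fin.suc)

  coprime-+-multiple⇔ : ∀ {n c x} → n ∣ c → Coprime (c + x) n ⇔ Coprime x n
  coprime-+-multiple⇔ {n} {c} {x} n∣c = mk⇔ drop add
    where
    drop : Coprime (c + x) n → Coprime x n
    drop cx⊥n (d∣x , d∣n) = cx⊥n (∣m∣n⇒∣m+n (∣-trans d∣n n∣c) d∣x , d∣n)
    add : Coprime x n → Coprime (c + x) n
    add x⊥n (d∣cx , d∣n) = x⊥n (∣m+n∣m⇒∣n d∣cx (∣-trans d∣n n∣c) , d∣n)

  coprime⇒prime-∤ : ∀ {q a b} → Prime q → Coprime a b → q ∣ a → ¬ q ∣ b
  coprime⇒prime-∤ q-prime a⊥b q∣a q∣b = ¬prime[1] (subst Prime (a⊥b (q∣a , q∣b)) q-prime)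

  coprime-prime⇔∤ : ∀ {x q} → Prime q → Coprime x q ⇔ (¬ q ∣ x)
  coprime-prime⇔∤ {x} {q} q-prime = mk⇔
    (λ (x⊥q : Coprime x q) q∣x → coprime⇒prime-∤ q-prime x⊥q q∣x ∣-refl)
    coprime-of-∤
    where
    coprime-of-∤ : ¬ q ∣ x → Coprime x q
    coprime-of-∤ q∤x {d} (d∣x , d∣q) with prime⇒irreducible q-prime d∣q
    ... | inj₁ d≡1 = d≡1
    ... | inj₂ refl = ⊥-elim (q∤x d∣x)

  distinct-primes-coprime : ∀ {p q} → Prime p → Prime q → p ≢ q → Coprime p q
  distinct-primes-coprime {p} {q} p-prime q-prime p≢q = from (coprime-prime⇔∤ q-prime) q∤p
    where
    q∤p : ¬ q ∣ p
    q∤p q∣p with prime⇒irreducible p-prime q∣p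
    ... | inj₁ refl = ¬prime[1] q-prime
    ... | inj₂ q≡p  = p≢q (sym q≡p)

  coprimeTo : ℕ → ℕ → Bool
  coprimeTo n x = does (coprime? x n)

  φ≡count-coprimeTo : ∀ n → φ n ≡ count (coprimeTo n) n
  φ≡count-coprimeTo n = begin
    φ n                                                ≡⟨ cong (length ∘ filter gcd≡1?) (map-upTo suc n) ⟩
    length (filter gcd≡1? (applyUpTo suc n))           ≡⟨ length-filter-applyUpTo gcd≡1? suc n ⟩
    count (does ∘ gcd≡1? ∘ suc) n                      ≡⟨ count-cong (λ x → does-⇔ (mk⇔ gcd≡1⇒coprime coprime⇒gcd≡1) (gcd≡1? (suc x)) (coprime? (suc x) n)) n ⟩
    count (coprimeTo n ∘ suc) n                        ≡⟨ count-shift (coprimeTo n) n n⊥n⇔0⊥n ⟩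
    count (coprimeTo n) n                              ∎
    where
    open ≡-Reasoning
    gcd≡1? : ∀ k → Dec (gcd k n ≡ 1)
    gcd≡1? k = gcd k n ≟ 1
    n⊥n⇔0⊥n : coprimeTo n n ≡ coprimeTo n 0
    n⊥n⇔0⊥n = does-⇔ (subst (λ z → Coprime z n ⇔ Coprime 0 n) (+-identityʳ n) (coprime-+-multiple⇔ ∣-refl))
      (coprime? n n) (coprime? 0 n)

  count-coprimeTo-multiple : ∀ n j → count (coprimeTo n) (j * n) ≡ j * φ n
  count-coprimeTo-multiple n j = begin
    count (coprimeTo n) (j * n) ≡⟨ count-periodic (coprimeTo n) n periodic j ⟩
    j * count (coprimeTo n) n   ≡⟨ cong (j *_) (sym (φ≡count-coprimeTo n)) ⟩
    j * φ n                     ∎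
    where
    open ≡-Reasoning
    periodic : ∀ x → coprimeTo n (n + x) ≡ coprimeTo n x
    periodic x = does-⇔ (coprime-+-multiple⇔ ∣-refl) (coprime? (n + x) n) (coprime? x n)

  count-coprimeTo-multiples : ∀ c .{{_ : NonZero c}} n → Coprime c n → ∀ M →
    count (λ x → coprimeTo n x ∧ does (c ∣? x)) (c * M) ≡ count (coprimeTo n) M
  count-coprimeTo-multiples c n c⊥n M = trans (count-multiples c (coprimeTo n) M)
    (count-cong (λ y → does-⇔ (coprime-*ˡ⇔ c⊥n) (coprime? (c * y) n) (coprime? y n)) M)

module VertexCuts where

  open Arithmetic
  open import Data.Bool using (Bool; true; false; _xor_)
  open import Data.Nat
  open import Data.Nat.Properties using (+-comm)
  open import Data.Nat.Divisibility
  open import Data.Nat.Coprimality using (Coprime; coprime?; gcd≡1⇒coprime)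
  open import Data.Nat.GCD using (gcd; gcd[m,n]∣m; gcd[m,n]∣n)
  open import Data.Fin using (toℕ; fromℕ<)
  open import Data.Fin.Properties using (toℕ-fromℕ<)
  open import Data.Fin.Subset using (Subset; _∉_)
  open import Data.Vec using (tabulate)
  open import Data.Vec.Properties using (lookup∘tabulate; lookup⇒[]=; []=⇒lookup)
  open import Data.Product using (_,_)
  open import Data.Sum using (inj₁; inj₂)
  open import Data.Empty using (⊥-elim)
  open import Function using (_∘′_)
  open import Function.Bundles using (_⇔_; mk⇔; Equivalence)
  open import Relation.Nullary using (¬_; Dec; yes; no; does)
  open import Relation.Nullary.Decidable using (dec-true; dec-false)
  open import Relation.Unary using (Pred; Decidable)
  open import Relation.Binary.PropositionalEquality using (_≡_; _≢_; refl; sym; trans; cong₂; subst)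
  open Equivalence using (to; from)

  ∉-tabulate : ∀ {n} {f : Fin n → Bool} {i} → i ∉ tabulate f → f i ≡ false
  ∉-tabulate {f = f} {i} i∉ with f i in fi≡
  ... | false = refl
  ... | true  = ⊥-elim (i∉ (lookup⇒[]= i (tabulate f) (trans (lookup∘tabulate f i) fi≡)))

  tabulate-∉ : ∀ {n} {f : Fin n → Bool} {i} → f i ≡ false → i ∉ tabulate f
  tabulate-∉ {f = f} {i} fi≡false i∈ with trans (sym ([]=⇒lookup i∈)) (trans (lookup∘tabulate f i) fi≡false)
  ... | ()

  does-xor≡false⇒⇔ : ∀ {a b} {A : Set a} {B : Set b} (A? : Dec A) (B? : Dec B) →
    does A? xor does B? ≡ false → A ⇔ B
  does-xor≡false⇒⇔ (yes a) (yes b) _ = mk⇔ (λ _ → b) (λ _ → a)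
  does-xor≡false⇒⇔ (no ¬a) (no ¬b) _ = mk⇔ (⊥-elim ∘′ ¬a) (⊥-elim ∘′ ¬b)
  does-xor≡false⇒⇔ (yes _) (no _)  ()
  does-xor≡false⇒⇔ (no _)  (yes _) ()

  Reach-source-∉ : ∀ {n Adj} {S : Subset n} {u w} → Reach Adj S u w → u ∉ S
  Reach-source-∉ (here u∉S)     = u∉S
  Reach-source-∉ (step u∉S _ _) = u∉S

  module _ {n} {Adj : Fin n → Fin n → Set} {S : Subset n} {c} {C : Pred (Fin n) c} (C? : Decidable C)
    (no-crossing : ∀ {u v} → u ∉ S → v ∉ S → C u → ¬ C v → ¬ Adj u v) where

    Reach-preserves : ∀ {u w} → Reach Adj S u w → C u → C w
    Reach-preserves (here _) Cu = Cu
    Reach-preserves (step {v = v} u∉S adj reach) Cu with C? v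
    ... | yes Cv = Reach-preserves reach Cv
    ... | no ¬Cv = ⊥-elim (no-crossing u∉S (Reach-source-∉ reach) Cu ¬Cv adj)

    disconnected-between : ∀ {u v} → u ∉ S → v ∉ S → C u → ¬ C v → Disconnected Adj S
    disconnected-between {u} {v} u∉S v∉S Cu ¬Cv = u , v , u∉S , v∉S , λ reach → ¬Cv (Reach-preserves reach Cu)

  IsPowerOf-∣ : ∀ {n d} {x y : Fin n} → d ∣ n → d ∣ toℕ x → IsPowerOf n y x → d ∣ toℕ y
  IsPowerOf-∣ {n} {d} {x} {y} d∣n d∣x (m , q , mx≡y+qn) =
    ∣m+n∣m⇒∣n (subst (d ∣_) (trans mx≡y+qn (+-comm (toℕ y) (q * n))) (∣-trans d∣x (n∣m*n m)))
              (∣-trans d∣n (n∣m*n q))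

  xorCut : ∀ n → ℕ → ℕ → Subset n
  xorCut n a b = tabulate (λ i → coprimeTo a (toℕ i) xor does (b ∣? toℕ i))

  ∉xorCut⇒⇔ : ∀ {n a b} {i : Fin n} → i ∉ xorCut n a b → Coprime (toℕ i) a ⇔ b ∣ toℕ i
  ∉xorCut⇒⇔ {a = a} {b} {i} = does-xor≡false⇒⇔ (coprime? (toℕ i) a) (b ∣? toℕ i) ∘′ ∉-tabulate

  xorCut-separating : ∀ {n a b} → a ∣ n → b ∣ n → a < n → b < n → a ≢ 1 → b ≢ 1 → Coprime b a →
    IsSeparating (PowerAdj n) (xorCut n a b)
  xorCut-separating {n} {a} {b} a∣n b∣n a<n b<n a≢1 b≢1 b⊥a =
    inj₁ (disconnected-between (λ i → coprime? (toℕ i) a) no-crossing u₀∉S v₀∉S u₀⊥a v₀⊥̸a)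
    where
    S : Subset n
    S = xorCut n a b
    no-crossing : ∀ {u v} → u ∉ S → v ∉ S → Coprime (toℕ u) a → ¬ Coprime (toℕ v) a → ¬ PowerAdj n u v
    no-crossing {u} {v} _ _ u⊥a v⊥̸a (_ , inj₁ u-power-of-v) =
      v⊥̸a (gcd≡1⇒coprime (u⊥a (IsPowerOf-∣ gcd∣n (gcd[m,n]∣m (toℕ v) a) u-power-of-v , gcd[m,n]∣n (toℕ v) a)))
      where
      gcd∣n : gcd (toℕ v) a ∣ n
      gcd∣n = ∣-trans (gcd[m,n]∣n (toℕ v) a) a∣n
    no-crossing u∉S v∉S u⊥a v⊥̸a (_ , inj₂ v-power-of-u) =
      v⊥̸a (from (∉xorCut⇒⇔ v∉S) (IsPowerOf-∣ b∣n (to (∉xorCut⇒⇔ u∉S) u⊥a) v-power-of-u))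
    u₀ v₀ : Fin n
    u₀ = fromℕ< b<n
    v₀ = fromℕ< a<n
    u₀⊥a : Coprime (toℕ u₀) a
    u₀⊥a rewrite toℕ-fromℕ< b<n = b⊥a
    b∣u₀ : b ∣ toℕ u₀
    b∣u₀ rewrite toℕ-fromℕ< b<n = ∣-refl
    v₀⊥̸a : ¬ Coprime (toℕ v₀) a
    v₀⊥̸a rewrite toℕ-fromℕ< a<n = λ a⊥a → a≢1 (a⊥a (∣-refl , ∣-refl))
    b∤v₀ : ¬ b ∣ toℕ v₀
    b∤v₀ rewrite toℕ-fromℕ< a<n = λ b∣a → b≢1 (b⊥a (∣-refl , b∣a))
    u₀∉S : u₀ ∉ S
    u₀∉S = tabulate-∉ (cong₂ _xor_ (dec-true (coprime? (toℕ u₀) a) u₀⊥a) (dec-true (b ∣? toℕ u₀) b∣u₀))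
    v₀∉S : v₀ ∉ S
    v₀∉S = tabulate-∉ (cong₂ _xor_ (dec-false (coprime? (toℕ v₀) a) v₀⊥̸a) (dec-false (b ∣? toℕ v₀) b∤v₀))

module PowerGraphCut
  (s : ℕ) (s≥1 : 1 ≤ s) (p e : Fin (suc s) → ℕ)
  (p-prime : ∀ i → Prime (p i))
  (p-increasing : ∀ i j → Data.Fin._<_ i j → p i < p j)
  (e≥1 : ∀ i → 1 ≤ e i)
  (k : ℕ) (k≤eᵣ∸1 : k ≤ e (fromℕ s) ∸ 1)
  where

  open Counting
  open Arithmetic
  open VertexCuts
  open import Data.Bool using (Bool; true; _∧_; _xor_; not)
  open import Data.Nat
  open import Data.Nat.Properties
  open import Data.Nat.Divisibility
  open import Data.Nat.Primality using (prime⇒nonZero)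
  open import Data.Nat.Coprimality using (Coprime; coprime?) renaming (sym to coprime-sym)
  open import Data.Nat.Tactic.RingSolver using (solve-∀)
  open import Data.Fin using (fromℕ<)
  import Data.Fin.Properties as Fin
  open import Data.Fin.Subset using (Subset; ∣_∣)
  open import Data.Product using (_×_; map)
  open import Function using (_∘_)
  open import Function.Bundles using (_⇔_; mk⇔; Equivalence)
  open import Relation.Nullary using (¬_; does; ¬?; _×-dec_)
  open import Relation.Nullary.Decidable using (does-⇔)
  open import Relation.Binary.PropositionalEquality using (_≡_; sym; trans; cong; cong₂; subst; subst₂; module ≡-Reasoning)
  open Equivalence using (to; from)

  pᵣ eᵣ P m′ n t : ℕ
  pᵣ = p (fromℕ s)
  eᵣ = e (fromℕ s)
  P  = ∏ (p ∘ inject₁)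
  m′ = ∏ (λ i → p (inject₁ i) ^ (e (inject₁ i) ∸ 1))
  n  = ∏ (λ i → p i ^ e i)
  t  = pᵣ ^ (eᵣ ∸ k)

  instance
    pᵣ≢0 : NonZero pᵣ
    pᵣ≢0 = prime⇒nonZero (p-prime (fromℕ s))
    t≢0 : NonZero t
    t≢0 = m^n≢0 pᵣ (eᵣ ∸ k)
    n≢0 : NonZero n
    n≢0 = ∏-nonZero _ (λ i → m^n≢0 (p i) (e i) {{prime⇒nonZero (p-prime i)}})

  k<eᵣ : k < eᵣ
  k<eᵣ = ≤-trans (s≤s k≤eᵣ∸1) (≤-reflexive (suc[n∸1]≡n (e≥1 (fromℕ s))))

  pᵣ^eᵣ≡pᵣ*pᵣ^[eᵣ∸1] : pᵣ ^ eᵣ ≡ pᵣ * pᵣ ^ (eᵣ ∸ 1)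
  pᵣ^eᵣ≡pᵣ*pᵣ^[eᵣ∸1] = cong (pᵣ ^_) (sym (suc[n∸1]≡n (e≥1 (fromℕ s))))

  pᵣ^eᵣ≡t*pᵣ^k : pᵣ ^ eᵣ ≡ t * pᵣ ^ k
  pᵣ^eᵣ≡t*pᵣ^k = trans (cong (pᵣ ^_) (sym (m∸n+n≡m (<⇒≤ k<eᵣ)))) (^-distribˡ-+-* pᵣ (eᵣ ∸ k) k)

  n≡pᵣ^eᵣ*m′*P : n ≡ pᵣ ^ eᵣ * m′ * P
  n≡pᵣ^eᵣ*m′*P = begin
    n                                              ≡⟨ ∏-init-last s (λ i → p i ^ e i) ⟩
    ∏ (λ i → p (inject₁ i) ^ e (inject₁ i)) * pᵣ ^ eᵣ ≡⟨ cong (_* pᵣ ^ eᵣ) (∏-cong peel) ⟩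
    ∏ (λ i → p (inject₁ i) ^ (e (inject₁ i) ∸ 1) * p (inject₁ i)) * pᵣ ^ eᵣ
      ≡⟨ cong (_* pᵣ ^ eᵣ) (∏-* _ (p ∘ inject₁)) ⟩
    m′ * P * pᵣ ^ eᵣ                                ≡⟨ rearrange m′ P (pᵣ ^ eᵣ) ⟩
    pᵣ ^ eᵣ * m′ * P                                ∎
    where
    open ≡-Reasoning
    peel : ∀ i → p (inject₁ i) ^ e (inject₁ i) ≡ p (inject₁ i) ^ (e (inject₁ i) ∸ 1) * p (inject₁ i)
    peel i = trans (cong (p (inject₁ i) ^_) (sym (suc[n∸1]≡n (e≥1 (inject₁ i))))) (*-comm (p (inject₁ i)) _)
    rearrange : ∀ a b c → a * b * c ≡ c * a * b
    rearrange = solve-∀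

  n≡c*[d*m′*P] : ∀ c d → pᵣ ^ eᵣ ≡ c * d → n ≡ c * (d * m′ * P)
  n≡c*[d*m′*P] c d pᵣ^eᵣ≡c*d = trans n≡pᵣ^eᵣ*m′*P (trans (cong (λ z → z * m′ * P) pᵣ^eᵣ≡c*d) (reassoc c d m′ P))
    where
    reassoc : ∀ a b c d → a * b * c * d ≡ a * (b * c * d)
    reassoc = solve-∀

  pᵢ<pᵣ : ∀ i → p (inject₁ i) < pᵣ
  pᵢ<pᵣ i = p-increasing (inject₁ i) (fromℕ s)
    (subst₂ _<_ (sym (Fin.toℕ-inject₁ i)) (sym (Fin.toℕ-fromℕ s)) (Fin.toℕ<n i))

  pᵣ⊥P : Coprime pᵣ P
  pᵣ⊥P = coprime-∏ (p ∘ inject₁) λ i →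
    distinct-primes-coprime (p-prime (fromℕ s)) (p-prime (inject₁ i)) (<⇒≢ (pᵢ<pᵣ i) ∘ sym)

  t⊥P : Coprime t P
  t⊥P = coprime-sym (from (coprime-^⇔ (m<n⇒0<n∸m k<eᵣ)) (coprime-sym pᵣ⊥P))

  coprime-n⇔ : ∀ {x} → Coprime x n ⇔ (Coprime x P × ¬ pᵣ ∣ x)
  coprime-n⇔ {x} = mk⇔
    (map (to m⇔) (to q⇔) ∘ to coprime-*ʳ⇔ ∘ subst (Coprime x) (∏-init-last s (λ i → p i ^ e i)))
    (subst (Coprime x) (sym (∏-init-last s (λ i → p i ^ e i))) ∘ from coprime-*ʳ⇔ ∘ map (from m⇔) (from q⇔))
    where
    m⇔ : Coprime x (∏ (λ i → p (inject₁ i) ^ e (inject₁ i))) ⇔ Coprime x P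
    m⇔ = coprime-∏-^⇔ (p ∘ inject₁) (e ∘ inject₁) (e≥1 ∘ inject₁)
    q⇔ : Coprime x (pᵣ ^ eᵣ) ⇔ (¬ pᵣ ∣ x)
    q⇔ = mk⇔ (to pᵣ⇔ ∘ to pow⇔) (from pow⇔ ∘ from pᵣ⇔)
      where
      pow⇔ = coprime-^⇔ {x} {pᵣ} (e≥1 (fromℕ s))
      pᵣ⇔ = coprime-prime⇔∤ {x} (p-prime (fromℕ s))

  cut : Subset n
  cut = xorCut n P t

  cut-separating : IsSeparating (PowerAdj n) cut
  cut-separating = xorCut-separating P∣n t∣n P<n t<n (prime-∣⇒≢1 p₀-prime p₀∣P) (prime-∣⇒≢1 pᵣ-prime pᵣ∣t) t⊥P
    where
    pᵣ-prime = p-prime (fromℕ s)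
    i₀ = fromℕ< s≥1
    p₀-prime = p-prime (inject₁ i₀)
    p₀∣P : p (inject₁ i₀) ∣ P
    p₀∣P = ∣-∏ (p ∘ inject₁) i₀
    pᵣ∣t : pᵣ ∣ t
    pᵣ∣t = ∣-^ (m<n⇒0<n∸m k<eᵣ)
    P∣n : P ∣ n
    P∣n = subst (P ∣_) (sym n≡pᵣ^eᵣ*m′*P) (n∣m*n (pᵣ ^ eᵣ * m′))
    t∣n : t ∣ n
    t∣n = subst (t ∣_) (sym (n≡c*[d*m′*P] t (pᵣ ^ k) pᵣ^eᵣ≡t*pᵣ^k)) (m∣m*n _)
    pᵣ∣n : pᵣ ∣ n
    pᵣ∣n = subst (pᵣ ∣_) (sym (n≡c*[d*m′*P] pᵣ (pᵣ ^ (eᵣ ∸ 1)) pᵣ^eᵣ≡pᵣ*pᵣ^[eᵣ∸1])) (m∣m*n _)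
    P<n : P < n
    P<n = ∣∧∤⇒< P∣n pᵣ∣n (coprime⇒prime-∤ pᵣ-prime pᵣ⊥P ∣-refl)
    t<n : t < n
    t<n = ∣∧∤⇒< t∣n (∣-trans p₀∣P P∣n) (λ p₀∣t → coprime⇒prime-∤ p₀-prime t⊥P p₀∣t p₀∣P)

  coprime-to-P divisible-by-pᵣ divisible-by-t : ℕ → Bool
  coprime-to-P     = coprimeTo P
  divisible-by-pᵣ x = does (pᵣ ∣? x)
  divisible-by-t  x = does (t ∣? x)

  count-coprime-to-P : count coprime-to-P n ≡ pᵣ ^ eᵣ * m′ * φ P
  count-coprime-to-P = trans (cong (count coprime-to-P) n≡pᵣ^eᵣ*m′*P) (count-coprimeTo-multiple P (pᵣ ^ eᵣ * m′))

  count-coprime-to-P-multiples : ∀ c .{{_ : NonZero c}} d → Coprime c P → pᵣ ^ eᵣ ≡ c * d →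
    count (λ x → coprime-to-P x ∧ does (c ∣? x)) n ≡ d * m′ * φ P
  count-coprime-to-P-multiples c d c⊥P pᵣ^eᵣ≡c*d = begin
    count (λ x → coprime-to-P x ∧ does (c ∣? x)) n           ≡⟨ cong (count _) (n≡c*[d*m′*P] c d pᵣ^eᵣ≡c*d) ⟩
    count (λ x → coprime-to-P x ∧ does (c ∣? x)) (c * (d * m′ * P)) ≡⟨ count-coprimeTo-multiples c P c⊥P (d * m′ * P) ⟩
    count coprime-to-P (d * m′ * P)                            ≡⟨ count-coprimeTo-multiple P (d * m′) ⟩
    d * m′ * φ P                                               ∎
    where open ≡-Reasoning

  count-divisible-by-t : count divisible-by-t n ≡ pᵣ ^ k * m′ * P
  count-divisible-by-t = begin
    count divisible-by-t n                        ≡⟨ cong (count divisible-by-t) (n≡c*[d*m′*P] t (pᵣ ^ k) pᵣ^eᵣ≡t*pᵣ^k) ⟩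
    count divisible-by-t (t * (pᵣ ^ k * m′ * P))   ≡⟨ count-multiples t (λ _ → true) (pᵣ ^ k * m′ * P) ⟩
    count (λ _ → true) (pᵣ ^ k * m′ * P)           ≡⟨ count-true (pᵣ ^ k * m′ * P) ⟩
    pᵣ ^ k * m′ * P                               ∎
    where open ≡-Reasoning

  φ[n]≡count : φ n ≡ count (λ x → coprime-to-P x ∧ not (divisible-by-pᵣ x)) n
  φ[n]≡count = trans (φ≡count-coprimeTo n)
    (count-cong (λ x → does-⇔ coprime-n⇔ (coprime? x n) (coprime? x P ×-dec ¬? (pᵣ ∣? x))) n)

  φ[n]-formula : φ n + pᵣ ^ (eᵣ ∸ 1) * m′ * φ P ≡ pᵣ ^ eᵣ * m′ * φ P
  φ[n]-formula = begin
    φ n + pᵣ ^ (eᵣ ∸ 1) * m′ * φ P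
      ≡⟨ cong₂ _+_ φ[n]≡count (sym (count-coprime-to-P-multiples pᵣ (pᵣ ^ (eᵣ ∸ 1)) pᵣ⊥P pᵣ^eᵣ≡pᵣ*pᵣ^[eᵣ∸1])) ⟩
    count (λ x → coprime-to-P x ∧ not (divisible-by-pᵣ x)) n + count (λ x → coprime-to-P x ∧ divisible-by-pᵣ x) n
      ≡⟨ count-∧-not coprime-to-P divisible-by-pᵣ n ⟩
    count coprime-to-P n
      ≡⟨ count-coprime-to-P ⟩
    pᵣ ^ eᵣ * m′ * φ P ∎
    where open ≡-Reasoning

  ∣cut∣-inclusion-exclusion : ∣ cut ∣ + 2 * (pᵣ ^ k * m′ * φ P) ≡ pᵣ ^ eᵣ * m′ * φ P + pᵣ ^ k * m′ * P
  ∣cut∣-inclusion-exclusion = begin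
    ∣ cut ∣ + 2 * (pᵣ ^ k * m′ * φ P)
      ≡⟨ cong₂ (λ a b → a + 2 * b) (∣tabulate∣≡count n _) (sym (count-coprime-to-P-multiples t (pᵣ ^ k) t⊥P pᵣ^eᵣ≡t*pᵣ^k)) ⟩
    count (λ x → coprime-to-P x xor divisible-by-t x) n + 2 * count (λ x → coprime-to-P x ∧ divisible-by-t x) n
      ≡⟨ count-xor coprime-to-P divisible-by-t n ⟩
    count coprime-to-P n + count divisible-by-t n
      ≡⟨ cong₂ _+_ count-coprime-to-P count-divisible-by-t ⟩
    pᵣ ^ eᵣ * m′ * φ P + pᵣ ^ k * m′ * P ∎
    where open ≡-Reasoning

  ∣cut∣-formula : ∣ cut ∣ + 2 * (pᵣ ^ k * m′ * φ P) ≡ φ n + pᵣ ^ (eᵣ ∸ 1) * m′ * φ P + pᵣ ^ k * m′ * P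
  ∣cut∣-formula = trans ∣cut∣-inclusion-exclusion (cong (_+ pᵣ ^ k * m′ * P) (sym φ[n]-formula))

open import Data.Integer using (ℤ; +_; _+_; _*_; _-_)
import Data.Integer as ℤ
import Data.Integer.Properties as ℤ
open import Data.Integer.Tactic.RingSolver using (solve-∀)
open import Data.Product using (_,_)
open import Data.Fin.Subset using (∣_∣)
open import Relation.Binary.PropositionalEquality using (_≡_; refl; sym; trans; cong; cong₂; subst; module ≡-Reasoning)
import Data.Nat as ℕ

pos-*³ : ∀ a b c → + (a ℕ.* b ℕ.* c) ≡ + a * + b * + c
pos-*³ a b c = trans (ℤ.pos-* (a ℕ.* b) c) (cong (_* + c) (ℤ.pos-* a b))

cut-size-in-ℤ : ∀ c f m a F K P →
  c ℕ.+ 2 ℕ.* (K ℕ.* m ℕ.* F) ≡ f ℕ.+ a ℕ.* m ℕ.* F ℕ.+ K ℕ.* m ℕ.* P →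
  + c ≡ + f + + m * (+ (a ℕ.* F) + + K * (+ P - + (2 ℕ.* F)))
cut-size-in-ℤ c f m a F K P c-eq = begin
  + c                                            ≡⟨ add-sub (+ c) X ⟩
  (+ c + X) - X                                  ≡⟨ cong (_- X) (sym (trans (ℤ.pos-+ c _) (cong (_+_ (+ c)) X-cast))) ⟩
  + (c ℕ.+ 2 ℕ.* (K ℕ.* m ℕ.* F)) - X            ≡⟨ cong (λ z → + z - X) c-eq ⟩
  + (f ℕ.+ a ℕ.* m ℕ.* F ℕ.+ K ℕ.* m ℕ.* P) - X  ≡⟨ cong (_- X) cast ⟩
  (+ f + + a * + m * + F + + K * + m * + P) - X  ≡⟨ regroup (+ f) (+ m) (+ a) (+ F) (+ K) (+ P) ⟩
  + f + + m * (+ a * + F + + K * (+ P - + 2 * + F))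
    ≡⟨ cong₂ (λ u v → + f + + m * (u + + K * (+ P - v))) (sym (ℤ.pos-* a F)) (sym (ℤ.pos-* 2 F)) ⟩
  + f + + m * (+ (a ℕ.* F) + + K * (+ P - + (2 ℕ.* F))) ∎
  where
  open ≡-Reasoning
  X : ℤ
  X = + 2 * (+ K * + m * + F)
  X-cast : + (2 ℕ.* (K ℕ.* m ℕ.* F)) ≡ X
  X-cast = trans (ℤ.pos-* 2 (K ℕ.* m ℕ.* F)) (cong (+ 2 *_) (pos-*³ K m F))
  cast : + (f ℕ.+ a ℕ.* m ℕ.* F ℕ.+ K ℕ.* m ℕ.* P) ≡ + f + + a * + m * + F + + K * + m * + P
  cast = trans (ℤ.pos-+ _ (K ℕ.* m ℕ.* P))
    (cong₂ _+_ (trans (ℤ.pos-+ f _) (cong (_+_ (+ f)) (pos-*³ a m F))) (pos-*³ K m P))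
  add-sub : ∀ x y → x ≡ (x + y) - y
  add-sub = solve-∀
  regroup : ∀ f m a F K P → (f + a * m * F + K * m * P) - + 2 * (K * m * F) ≡ f + m * (a * F + K * (P - + 2 * F))
  regroup = solve-∀

corollary3p3 : (s : ℕ) → 1 ≤ s →
    (p e : Fin (suc s) → ℕ) →
    (∀ i → Prime (p i)) →
    (∀ i j → Data.Fin._<_ i j → p i < p j) →
    (∀ i → 1 ≤ e i) →
    (n : ℕ) → n ≡ ∏ (λ i → p i ^ e i) →
    (k : ℕ) → k ≤ e (fromℕ s) ∸ 1 →
    (κ : ℕ) → IsVertexConnectivity (PowerAdj n) κ →
    (+ κ) ℤ.≤ (+ φ n) + (+ ∏ (λ i → p (inject₁ i) ^ (e (inject₁ i) ∸ 1)))
    * ((+ (p (fromℕ s) ^ (e (fromℕ s) ∸ 1) Data.Nat.* φ (∏ (λ i → p (inject₁ i)))))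
    + (+ (p (fromℕ s) ^ k)) * ((+ ∏ (λ i → p (inject₁ i))) - (+ (2 Data.Nat.* φ (∏ (λ i → p (inject₁ i)))))))
corollary3p3 s s≥1 p e p-prime p-increasing e≥1 _ refl k k≤eᵣ∸1 κ (_ , κ-minimal) =
  subst (+ κ ℤ.≤_) (cut-size-in-ℤ ∣ cut ∣ (φ n) m′ (pᵣ ^ (eᵣ ∸ 1)) (φ P) (pᵣ ^ k) P ∣cut∣-formula)
    (ℤ.+≤+ (κ-minimal cut cut-separating))
  where open PowerGraphCut s s≥1 p e p-prime p-increasing e≥1 k k≤eᵣ∸1
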